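{- Let $\mathbf A=(A;\wedge,d)$ be an SMB algebra over the congruence ${\sim}$ (not necessarily finite), and let $\theta$ be a congruence of $\mathbf A$. If $(a,b)\in{\sim}\vee\theta$, then there exists $e\in[a]_{{\sim}\vee\theta}$ such that $[e]_{\sim}\le[a\wedge b]_{\sim}$ and $\{[x]_\theta:x\in[a]_{\sim}\}\cup\{[x]_\theta:x\in[b]_{\sim}\}\subseteq\{[x]_\theta:x\in[e]_{\sim}\}$.
   Context: An algebra $\mathbf A=(A;\wedge,d)$ is idempotent if $x\wedge x=x$ and $d(x,x,x)=x$ for all $x$. For a congruence ${\sim}$ of $\mathbf A$, $\mathbf A$ is an SMB algebra over ${\sim}$ if it is idempotent, $(A/{\sim};\wedge)$ is a semilattice, and on each ${\sim}$-class $\wedge$ acts as the second projection and $d$ acts as a Mal'cev operation ($d(x,y,y)=x=d(y,y,x)$). The order on $A/{\sim}$ is the semilattice order: $[u]_{\sim}\le[v]_{\sim}$ iff $[u]_{\sim}\wedge[v]_{\sim}=[u]_{\sim}$. ${\sim}\vee\theta$ is the join in the congruence lattice. -}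

module Defs where

open import Level using (Level; suc; _⊔_)
open import Data.Product using (Σ; _×_; _,_; ∃)
open import Relation.Binary.Core using (Rel)
open import Relation.Binary.Structures using (IsEquivalence)
open import Relation.Binary.PropositionalEquality using (_≡_)

record Algebra : Set₁ where
  field
    Carrier : Set
    _∧_     : Carrier → Carrier → Carrier
    d       : Carrier → Carrier → Carrier → Carrier

module _ (𝐀 : Algebra) where
  open Algebra 𝐀

  record IsCongruence (θ : Rel Carrier Level.zero) : Set where
    field
      isEquivalence : IsEquivalence θ
      ∧-cong : ∀ {x x′ y y′} → θ x x′ → θ y y′ → θ (x ∧ y) (x′ ∧ y′)
      d-cong : ∀ {x x′ y y′ z z′} → θ x x′ → θ y y′ → θ z z′
               → θ (d x y z) (d x′ y′ z′)

  -- Join of two congruences in the congruence lattice: the least congruence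
  -- containing both (intersection of all congruences containing both).
  Join : Rel Carrier Level.zero → Rel Carrier Level.zero → Rel Carrier (suc Level.zero)
  Join ∼ θ a b = (ψ : Rel Carrier Level.zero) → IsCongruence ψ
                 → (∀ {x y} → ∼ x y → ψ x y) → (∀ {x y} → θ x y → ψ x y) → ψ a b

  record IsSMB (∼ : Rel Carrier Level.zero) : Set where
    field
      congruence : IsCongruence ∼
      ∧-idem : ∀ x → x ∧ x ≡ x
      d-idem : ∀ x → d x x x ≡ x
      -- (A/∼; ∧) is a semilattice
      ∧-assoc/∼ : ∀ x y z → ∼ ((x ∧ y) ∧ z) (x ∧ (y ∧ z))
      ∧-comm/∼  : ∀ x y → ∼ (x ∧ y) (y ∧ x)
      ∧-idem/∼  : ∀ x → ∼ (x ∧ x) x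
      ∧-proj₂ : ∀ {x y} → ∼ x y → x ∧ y ≡ y
      d-malcevˡ : ∀ {x y} → ∼ x y → d x y y ≡ x
      d-malcevʳ : ∀ {x y} → ∼ x y → d y y x ≡ x

  -- semilattice order on A/∼:  [u]∼ ≤ [v]∼  iff  [u]∼ ∧ [v]∼ = [u]∼
  _≤[_]_ : Carrier → Rel Carrier Level.zero → Carrier → Set
  u ≤[ ∼ ] v = ∼ (u ∧ v) u

{-# OPTIONS --safe #-}
-- The join ∼ ∨ θ is the transitive closure of ∼ ∪ θ, so it suffices to show
-- that the relation "u and v have a common lower bound e in A/∼ such that
-- [u]_θ and [v]_θ both meet [e]_∼" contains ∼ and θ and is transitive.
-- For θ take e = u ∧ v; for a chain u – v – w with witnesses e₁, e₂ take
-- e₁ ∧ e₂, using that ∧ is the second projection inside a ∼-class to move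
-- along θ-classes.  Finally, if [a]_θ meets [e]_∼ and [e]_∼ ≤ [a]_∼, then
-- [x]_θ meets [e]_∼ for every x ∼ a, which gives the inclusion of θ-classes.
module Submission where

open import Defs
open import Level using (0ℓ)
open import Data.Product using (Σ; _×_; _,_)
open import Data.Sum using (inj₁; inj₂)
import Data.Sum as Sum
open import Function using (_∘_)
open import Relation.Binary.Core using (Rel; _⇒_; _Preserves_⟶_)
open import Relation.Binary.Definitions using (Transitive)
open import Relation.Binary.Structures using (IsEquivalence)
open import Relation.Binary.Bundles using (Setoid)
open import Relation.Binary.PropositionalEquality using (sym)
open import Relation.Binary.Construct.Union as Union using (_∪_)
open import Relation.Binary.Construct.Closure.Transitive as Plus
  using (TransClosure; [_]; _∷_; _++_)

TransClosure-least : ∀ {A : Set} {R S : Rel A 0ℓ} →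
                     R ⇒ S → Transitive S → TransClosure R ⇒ S
TransClosure-least R⇒S S-trans [ r ]     = R⇒S r
TransClosure-least R⇒S S-trans (r ∷ rs) = S-trans (R⇒S r) (TransClosure-least R⇒S S-trans rs)

module JoinAsTransClosure (𝐀 : Algebra) {∼ θ : Rel (Algebra.Carrier 𝐀) 0ℓ}
                          (∼-cong : IsCongruence 𝐀 ∼) (θ-cong : IsCongruence 𝐀 θ) where
  open Algebra 𝐀
  private
    module C∼ = IsCongruence ∼-cong
    module Cθ = IsCongruence θ-cong
    module E∼ = IsEquivalence C∼.isEquivalence
    module Eθ = IsEquivalence Cθ.isEquivalence

  infix 4 _≋_
  _≋_ : Rel Carrier 0ℓ
  _≋_ = TransClosure (∼ ∪ θ)

  ∼⇒≋ : ∼ ⇒ _≋_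
  ∼⇒≋ x∼y = [ inj₁ x∼y ]

  θ⇒≋ : θ ⇒ _≋_
  θ⇒≋ xθy = [ inj₂ xθy ]

  ≋-preserved : (f : Carrier → Carrier) → f Preserves ∼ ⟶ ∼ → f Preserves θ ⟶ θ →
                f Preserves _≋_ ⟶ _≋_
  ≋-preserved f f∼ fθ = TransClosure-least Sum.[ ∼⇒≋ ∘ f∼ , θ⇒≋ ∘ fθ ] _++_

  ≋-isCongruence : IsCongruence 𝐀 _≋_
  ≋-isCongruence = record
    { isEquivalence = record
      { refl  = ∼⇒≋ E∼.refl
      ; sym   = Plus.symmetric (∼ ∪ θ) (Union.symmetric {L = ∼} {R = θ} E∼.sym Eθ.sym)
      ; trans = _++_
      }
    ; ∧-cong = λ {x′ = x′} {y = y} x≋x′ y≋y′ →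
        ≋-preserved (_∧ y) (λ p → C∼.∧-cong p E∼.refl) (λ p → Cθ.∧-cong p Eθ.refl) x≋x′
        ++ ≋-preserved (x′ ∧_) (C∼.∧-cong E∼.refl) (Cθ.∧-cong Eθ.refl) y≋y′
    ; d-cong = λ {x′ = x′} {y = y} {y′ = y′} {z = z} x≋x′ y≋y′ z≋z′ →
        ≋-preserved (λ t → d t y z) (λ p → C∼.d-cong p E∼.refl E∼.refl)
                                    (λ p → Cθ.d-cong p Eθ.refl Eθ.refl) x≋x′
        ++ ≋-preserved (λ t → d x′ t z) (λ p → C∼.d-cong E∼.refl p E∼.refl)
                                       (λ p → Cθ.d-cong Eθ.refl p Eθ.refl) y≋y′
        ++ ≋-preserved (d x′ y′) (C∼.d-cong E∼.refl E∼.refl) (Cθ.d-cong Eθ.refl Eθ.refl) z≋z′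
    }

  Join⇒≋ : ∀ {a b} → Join 𝐀 ∼ θ a b → a ≋ b
  Join⇒≋ a∨b = a∨b _≋_ ≋-isCongruence ∼⇒≋ θ⇒≋

  ≋⇒Join : ∀ {a b} → a ≋ b → Join 𝐀 ∼ θ a b
  ≋⇒Join a≋b ψ ψ-cong ∼⇒ψ θ⇒ψ =
    TransClosure-least Sum.[ ∼⇒ψ , θ⇒ψ ]
                       (IsEquivalence.trans (IsCongruence.isEquivalence ψ-cong)) a≋b

module SMBAlgebra {𝐀 : Algebra} {∼ : Rel (Algebra.Carrier 𝐀) 0ℓ} (smb : IsSMB 𝐀 ∼) where
  open Algebra 𝐀
  open IsSMB smb
  private
    module C∼ = IsCongruence congruence
    module E∼ = IsEquivalence C∼.isEquivalence

    ∼-setoid : Setoid 0ℓ 0ℓ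
    ∼-setoid = record { isEquivalence = C∼.isEquivalence }

  open import Relation.Binary.Reasoning.Setoid ∼-setoid

  infix 4 _≤_
  _≤_ : Rel Carrier 0ℓ
  e ≤ u = _≤[_]_ 𝐀 e ∼ u

  ∼⇒≤ : ∀ {u v} → ∼ u v → u ≤ v
  ∼⇒≤ u∼v = E∼.trans (E∼.reflexive (∧-proj₂ u∼v)) (E∼.sym u∼v)

  ≤-trans : ∀ {e u v} → e ≤ u → u ≤ v → e ≤ v
  ≤-trans {e} {u} {v} e≤u u≤v = begin
    e ∧ v        ≈⟨ C∼.∧-cong e≤u E∼.refl ⟨
    (e ∧ u) ∧ v  ≈⟨ ∧-assoc/∼ e u v ⟩
    e ∧ (u ∧ v)  ≈⟨ C∼.∧-cong E∼.refl u≤v ⟩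
    e ∧ u        ≈⟨ e≤u ⟩
    e            ∎

  x∧y≤y : ∀ x y → x ∧ y ≤ y
  x∧y≤y x y = E∼.trans (∧-assoc/∼ x y y) (C∼.∧-cong E∼.refl (∧-idem/∼ y))

  x∧y≤x : ∀ x y → x ∧ y ≤ x
  x∧y≤x x y = begin
    (x ∧ y) ∧ x  ≈⟨ ∧-assoc/∼ x y x ⟩
    x ∧ (y ∧ x)  ≈⟨ C∼.∧-cong E∼.refl (∧-comm/∼ y x) ⟩
    x ∧ (x ∧ y)  ≈⟨ ∧-assoc/∼ x x y ⟨
    (x ∧ x) ∧ y  ≈⟨ C∼.∧-cong (∧-idem/∼ x) E∼.refl ⟩
    x ∧ y        ∎

  ≤-glb : ∀ {e u v} → e ≤ u → e ≤ v → e ≤ u ∧ v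
  ≤-glb {e} {u} {v} e≤u e≤v = begin
    e ∧ (u ∧ v)  ≈⟨ ∧-assoc/∼ e u v ⟨
    (e ∧ u) ∧ v  ≈⟨ C∼.∧-cong e≤u E∼.refl ⟩
    e ∧ v        ≈⟨ e≤v ⟩
    e            ∎

  module WithCongruence {θ : Rel Carrier 0ℓ} (θ-cong : IsCongruence 𝐀 θ) where
    private
      module Cθ = IsCongruence θ-cong
      module Eθ = IsEquivalence Cθ.isEquivalence
      open JoinAsTransClosure 𝐀 congruence θ-cong

    infix 4 _⇝_
    _⇝_ : Rel Carrier 0ℓ
    u ⇝ e = Σ Carrier λ y → ∼ y e × θ u y

    ⇝-respʳ-∼ : ∀ {u e e′} → u ⇝ e → ∼ e e′ → u ⇝ e′
    ⇝-respʳ-∼ (y , y∼e , uθy) e∼e′ = y , E∼.trans y∼e e∼e′ , uθy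

    -- Inside [e]_∼ the element z ∧ y equals y, while z can be moved along θ.
    θ-via-∧ : ∀ {u y z z′} → θ u y → ∼ z y → θ z z′ → θ u (z′ ∧ y)
    θ-via-∧ uθy z∼y zθz′ =
      Eθ.trans uθy (Eθ.trans (Eθ.reflexive (sym (∧-proj₂ z∼y))) (Cθ.∧-cong zθz′ Eθ.refl))

    ⇝-∧ : ∀ {u v e₁ e₂} → u ⇝ e₁ → v ⇝ e₁ → v ⇝ e₂ → u ⇝ e₂ ∧ e₁
    ⇝-∧ (y , y∼e₁ , uθy) (z , z∼e₁ , vθz) (z′ , z′∼e₂ , vθz′) =
      z′ ∧ y , C∼.∧-cong z′∼e₂ y∼e₁
             , θ-via-∧ uθy (E∼.trans z∼e₁ (E∼.sym y∼e₁)) (Eθ.trans (Eθ.sym vθz) vθz′)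

    ⇝-below : ∀ {a e x} → e ≤ a → a ⇝ e → ∼ x a → x ⇝ e
    ⇝-below {x = x} e≤a (y , y∼e , aθy) x∼a =
      y ∧ x , E∼.trans (C∼.∧-cong y∼e x∼a) e≤a
            , θ-via-∧ Eθ.refl (E∼.sym x∼a) aθy

    Bridged : Rel Carrier 0ℓ
    Bridged u v = Σ Carrier λ e → e ≤ u × e ≤ v × u ⇝ e × v ⇝ e

    ∼⇒Bridged : ∀ {u v} → ∼ u v → Bridged u v
    ∼⇒Bridged {u} {v} u∼v =
      u , ∼⇒≤ E∼.refl , ∼⇒≤ u∼v , (u , E∼.refl , Eθ.refl) , (v , E∼.sym u∼v , Eθ.refl)

    θ⇒Bridged : ∀ {u v} → θ u v → Bridged u v
    θ⇒Bridged {u} {v} uθv =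
      u ∧ v , x∧y≤x u v , x∧y≤y u v
            , (u ∧ v , E∼.refl , Eθ.trans (Eθ.reflexive (sym (∧-idem u)))
                                          (Cθ.∧-cong Eθ.refl uθv))
            , (u ∧ v , E∼.refl , Eθ.trans (Eθ.reflexive (sym (∧-idem v)))
                                          (Cθ.∧-cong (Eθ.sym uθv) Eθ.refl))

    Bridged-trans : Transitive Bridged
    Bridged-trans (e₁ , e₁≤u , e₁≤v , u⇝e₁ , v⇝e₁) (e₂ , e₂≤v , e₂≤w , v⇝e₂ , w⇝e₂) =
      e₁ ∧ e₂ , ≤-trans (x∧y≤x e₁ e₂) e₁≤u , ≤-trans (x∧y≤y e₁ e₂) e₂≤w
              , ⇝-respʳ-∼ (⇝-∧ u⇝e₁ v⇝e₁ v⇝e₂) (∧-comm/∼ e₂ e₁)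
              , ⇝-∧ w⇝e₂ v⇝e₂ v⇝e₁

    Join⇒Bridged : ∀ {a b} → Join 𝐀 ∼ θ a b → Bridged a b
    Join⇒Bridged = TransClosure-least Sum.[ ∼⇒Bridged , θ⇒Bridged ] Bridged-trans ∘ Join⇒≋

    ⇝⇒Join : ∀ {a e} → a ⇝ e → Join 𝐀 ∼ θ a e
    ⇝⇒Join (y , y∼e , aθy) = ≋⇒Join (θ⇒≋ aθy ++ ∼⇒≋ y∼e)

lemma4p2 : (𝐀 : Algebra) → let open Algebra 𝐀 in
    (∼ θ : Rel Carrier 0ℓ) → IsSMB 𝐀 ∼ → IsCongruence 𝐀 θ →
    (a b : Carrier) → Join 𝐀 ∼ θ a b →
    Σ Carrier λ e →
    Join 𝐀 ∼ θ a e
    × _≤[_]_ 𝐀 e ∼ (a ∧ b)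
    × (∀ x → ∼ x a → Σ Carrier λ y → ∼ y e × θ x y)
    × (∀ x → ∼ x b → Σ Carrier λ y → ∼ y e × θ x y)
lemma4p2 𝐀 ∼ θ smb θ-cong a b a∨b =
  let e , e≤a , e≤b , a⇝e , b⇝e = Join⇒Bridged a∨b
  in e , ⇝⇒Join a⇝e , ≤-glb e≤a e≤b , (λ _ → ⇝-below e≤a a⇝e) , (λ _ → ⇝-below e≤b b⇝e)
  where open SMBAlgebra smb
        open SMBAlgebra.WithCongruence smb θ-cong
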